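{- Let $n$ and $r$ be positive integers with $\frac{25}{9}r-1\le n<\frac{14}{5}r-1$. Then $\rho_2(n,r)=4$.
   Context: For integers $n\ge 2r\ge 2$, the Kneser graph $K(n,r)$ has as vertices the $r$-element subsets of $[n]=\{1,\dots,n\}$, two vertices being adjacent iff they are disjoint. A 2-packing of a graph is a set of vertices that are pairwise at distance at least $3$ (no two adjacent and no two with a common neighbor); $\rho_2(n,r)$ is the maximum cardinality of a 2-packing of $K(n,r)$. -}

module Defs where

open import Data.Nat using (ℕ)
open import Data.Fin.Subset using (Subset; _∩_; ∣_∣; Empty)
open import Data.List using (List; length)
open import Data.List.Relation.Unary.All using (All)
open import Data.List.Relation.Unary.Unique.Propositional using (Unique)
open import Data.List.Relation.Unary.AllPairs using (AllPairs)
open import Data.Product using (_×_; Σ)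
open import Relation.Nullary using (¬_)
open import Relation.Binary.PropositionalEquality using (_≡_)

-- Vertices of the Kneser graph K(n,r): r-element subsets of [n] (here Fin n).
IsVertex : (n r : ℕ) → Subset n → Set
IsVertex n r A = ∣ A ∣ ≡ r

Adjacent : {n : ℕ} → Subset n → Subset n → Set
Adjacent A B = Empty (A ∩ B)

CommonNeighbour : (n r : ℕ) → Subset n → Subset n → Set
CommonNeighbour n r A B = Σ (Subset n) λ C → IsVertex n r C × Adjacent A C × Adjacent B C

-- Two distinct vertices are at distance at least 3: not adjacent, no common neighbour.
FarApart : (n r : ℕ) → Subset n → Subset n → Set
FarApart n r A B = ¬ Adjacent A B × ¬ CommonNeighbour n r A B

Is2Packing : (n r : ℕ) → List (Subset n) → Set
Is2Packing n r P = All (IsVertex n r) P × Unique P × AllPairs (FarApart n r) P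

ρ₂≡ : (n r k : ℕ) → Set
ρ₂≡ n r k =
  Σ (List (Subset n)) (λ P → Is2Packing n r P × length P ≡ k)
  × (∀ (P : List (Subset n)) → Is2Packing n r P → length P Data.Nat.≤ k)

-- Vertices X, Y of K(n,r) have a common neighbour iff r + |X ∪ Y| ≤ n, so for
-- vertices "distance ≥ 3" means 0 < |X ∩ Y| and n + |X ∩ Y| < 3r.
-- Upper bound: by the Bonferroni inequality, k pairwise far-apart vertices satisfy
-- kr ≤ n + C(k,2)(3r − n − 1), and for k = 5 this contradicts 25r ≤ 9(n + 1).
-- Lower bound: put t = 3r − n − 1 and p = r − 3t, and split [n] into six blocks of
-- size t (one for each pair of four sets), four blocks of size p (one for each set)
-- and a remainder.  Each set consists of its three pair-blocks and its own block,
-- so two of them meet in exactly t points; 5(n + 1) < 14r makes the blocks fit.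
module Submission where

open import Data.Bool.Base using (_∧_)
open import Data.Empty using (⊥; ⊥-elim)
open import Data.Fin.Subset
  using (Subset; inside; outside; _⊆_; _∩_; _∪_; ∁; ⋃; ∣_∣; Empty)
  renaming (⊥ to ∅)
open import Data.Fin.Subset.Properties
open import Data.List using (List; []; _∷_; length; map; take)
open import Data.List.Properties using (length-take)
open import Data.List.Relation.Unary.All as All using (All; []; _∷_)
import Data.List.Relation.Unary.All.Properties as All
open import Data.List.Relation.Unary.AllPairs as AllPairs using (AllPairs; []; _∷_)
import Data.List.Relation.Unary.AllPairs.Properties as AllPairs
open import Data.Nat
open import Data.Nat.Combinatorics using (_C_; nC1≡n; nCk+nC[k+1]≡[n+1]C[k+1])
open import Data.Nat.ListAction using (sum)
open import Data.Nat.Properties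
open import Data.Nat.Tactic.RingSolver using (solve-∀)
open import Data.Product using (∃-syntax; _×_; _,_; proj₁; proj₂)
open import Data.Sum using (inj₁; inj₂)
open import Data.Vec using ([]; _∷_; _++_; replicate)
open import Data.Vec.Properties using (zipWith-++; zipWith-replicate)
open import Function.Base using (_∘_)
open import Function.Bundles using (_⇔_; mk⇔; Equivalence)
open import Level using (Level)
open import Relation.Nullary using (¬_; yes; no)
open import Relation.Binary.PropositionalEquality

open import Defs

private
  variable
    a ℓ₁ ℓ₂ ℓ₃ : Level
    A : Set a

∣p++q∣≡∣p∣+∣q∣ : ∀ {m n} (p : Subset m) (q : Subset n) → ∣ p ++ q ∣ ≡ ∣ p ∣ + ∣ q ∣
∣p++q∣≡∣p∣+∣q∣ []            q = refl
∣p++q∣≡∣p∣+∣q∣ (inside  ∷ p) q = cong suc (∣p++q∣≡∣p∣+∣q∣ p q)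
∣p++q∣≡∣p∣+∣q∣ (outside ∷ p) q = ∣p++q∣≡∣p∣+∣q∣ p q

∣p∪q∣+∣p∩q∣≡∣p∣+∣q∣ : ∀ {n} (p q : Subset n) → ∣ p ∪ q ∣ + ∣ p ∩ q ∣ ≡ ∣ p ∣ + ∣ q ∣
∣p∪q∣+∣p∩q∣≡∣p∣+∣q∣ []            []            = refl
∣p∪q∣+∣p∩q∣≡∣p∣+∣q∣ (inside  ∷ p) (inside  ∷ q) = cong suc (begin
  ∣ p ∪ q ∣ + suc ∣ p ∩ q ∣    ≡⟨ +-suc _ _ ⟩
  suc (∣ p ∪ q ∣ + ∣ p ∩ q ∣)  ≡⟨ cong suc (∣p∪q∣+∣p∩q∣≡∣p∣+∣q∣ p q) ⟩
  suc (∣ p ∣ + ∣ q ∣)          ≡⟨ +-suc _ _ ⟨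
  ∣ p ∣ + suc ∣ q ∣            ∎)
  where open ≡-Reasoning
∣p∪q∣+∣p∩q∣≡∣p∣+∣q∣ (inside  ∷ p) (outside ∷ q) = cong suc (∣p∪q∣+∣p∩q∣≡∣p∣+∣q∣ p q)
∣p∪q∣+∣p∩q∣≡∣p∣+∣q∣ (outside ∷ p) (inside  ∷ q) =
  trans (cong suc (∣p∪q∣+∣p∩q∣≡∣p∣+∣q∣ p q)) (sym (+-suc _ _))
∣p∪q∣+∣p∩q∣≡∣p∣+∣q∣ (outside ∷ p) (outside ∷ q) = ∣p∪q∣+∣p∩q∣≡∣p∣+∣q∣ p q

∣p∪q∣≤∣p∣+∣q∣ : ∀ {n} (p q : Subset n) → ∣ p ∪ q ∣ ≤ ∣ p ∣ + ∣ q ∣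
∣p∪q∣≤∣p∣+∣q∣ p q = ≤-trans (m≤m+n _ _) (≤-reflexive (∣p∪q∣+∣p∩q∣≡∣p∣+∣q∣ p q))

Empty⇒∣p∣≡0 : ∀ {n} {p : Subset n} → Empty p → ∣ p ∣ ≡ 0
Empty⇒∣p∣≡0 {n} p=∅ = trans (cong ∣_∣ (Empty-unique p=∅)) (∣⊥∣≡0 n)

Empty[p∩q]⇒∣p∣+∣q∣≤n : ∀ {n} (p q : Subset n) → Empty (p ∩ q) → ∣ p ∣ + ∣ q ∣ ≤ n
Empty[p∩q]⇒∣p∣+∣q∣≤n {n} p q p∩q=∅ = begin
  ∣ p ∣ + ∣ q ∣          ≡⟨ ∣p∪q∣+∣p∩q∣≡∣p∣+∣q∣ p q ⟨
  ∣ p ∪ q ∣ + ∣ p ∩ q ∣  ≡⟨ cong (∣ p ∪ q ∣ +_) (Empty⇒∣p∣≡0 p∩q=∅) ⟩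
  ∣ p ∪ q ∣ + 0          ≡⟨ +-identityʳ _ ⟩
  ∣ p ∪ q ∣              ≤⟨ ∣p∣≤n (p ∪ q) ⟩
  n                      ∎
  where open ≤-Reasoning

subset-of-size : ∀ {n} k (p : Subset n) → k ≤ ∣ p ∣ → ∃[ q ] q ⊆ p × ∣ q ∣ ≡ k
subset-of-size {n} zero    p             _            = ∅ , ⊥⊆ , ∣⊥∣≡0 n
subset-of-size     (suc k) (inside  ∷ p) (s≤s k≤∣p∣)  =
  let q , q⊆p , ∣q∣≡k = subset-of-size k p k≤∣p∣ in inside ∷ q , in⊆in q⊆p , cong suc ∣q∣≡k
subset-of-size     (suc k) (outside ∷ p) 1+k≤∣p∣      =
  let q , q⊆p , ∣q∣≡k = subset-of-size (suc k) p 1+k≤∣p∣ in outside ∷ q , out⊆ q⊆p , ∣q∣≡k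

commonNeighbour⇔ : ∀ {n r} (X Y : Subset n) → CommonNeighbour n r X Y ⇔ r + ∣ X ∪ Y ∣ ≤ n
commonNeighbour⇔ {n} {r} X Y = mk⇔ to from
  where
  to : CommonNeighbour n r X Y → r + ∣ X ∪ Y ∣ ≤ n
  to (Z , ∣Z∣≡r , X∩Z=∅ , Y∩Z=∅) =
    subst (λ k → k + ∣ X ∪ Y ∣ ≤ n) ∣Z∣≡r (Empty[p∩q]⇒∣p∣+∣q∣≤n Z (X ∪ Y) Z∩[X∪Y]=∅)
    where
    Z∩[X∪Y]=∅ : Empty (Z ∩ (X ∪ Y))
    Z∩[X∪Y]=∅ (i , i∈Z∩[X∪Y]) with x∈p∩q⁻ Z (X ∪ Y) i∈Z∩[X∪Y]
    ... | i∈Z , i∈X∪Y with x∈p∪q⁻ X Y i∈X∪Y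
    ...   | inj₁ i∈X = X∩Z=∅ (i , x∈p∩q⁺ (i∈X , i∈Z))
    ...   | inj₂ i∈Y = Y∩Z=∅ (i , x∈p∩q⁺ (i∈Y , i∈Z))

  from : r + ∣ X ∪ Y ∣ ≤ n → CommonNeighbour n r X Y
  from r+∣X∪Y∣≤n
    with subset-of-size r (∁ (X ∪ Y))
           (subst (r ≤_) (sym (∣∁p∣≡n∸∣p∣ (X ∪ Y))) (m+n≤o⇒m≤o∸n r r+∣X∪Y∣≤n))
  ... | Z , Z⊆∁[X∪Y] , ∣Z∣≡r = Z , ∣Z∣≡r , avoids X (p⊆p∪q Y) , avoids Y (q⊆p∪q X Y)
    where
    avoids : ∀ V → V ⊆ X ∪ Y → Empty (V ∩ Z)
    avoids V V⊆X∪Y (i , i∈V∩Z) =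
      let i∈V , i∈Z = x∈p∩q⁻ V Z i∈V∩Z in x∈∁p⇒x∉p (Z⊆∁[X∪Y] i∈Z) (V⊆X∪Y i∈V)

¬commonNeighbour⇔ : ∀ {n r} {X Y : Subset n} → IsVertex n r X → IsVertex n r Y →
                    (¬ CommonNeighbour n r X Y) ⇔ n + ∣ X ∩ Y ∣ < 3 * r
¬commonNeighbour⇔ {n} {r} {X} {Y} ∣X∣≡r ∣Y∣≡r = mk⇔ to from
  where
  3r≡ : r + ∣ X ∪ Y ∣ + ∣ X ∩ Y ∣ ≡ 3 * r
  3r≡ = begin
    r + ∣ X ∪ Y ∣ + ∣ X ∩ Y ∣    ≡⟨ +-assoc r _ _ ⟩
    r + (∣ X ∪ Y ∣ + ∣ X ∩ Y ∣)  ≡⟨ cong (r +_) (∣p∪q∣+∣p∩q∣≡∣p∣+∣q∣ X Y) ⟩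
    r + (∣ X ∣ + ∣ Y ∣)          ≡⟨ cong₂ (λ x y → r + (x + y)) ∣X∣≡r ∣Y∣≡r ⟩
    r + (r + r)                  ≡⟨ cong (λ z → r + (r + z)) (+-identityʳ r) ⟨
    3 * r                        ∎
    where open ≡-Reasoning

  to : ¬ CommonNeighbour n r X Y → n + ∣ X ∩ Y ∣ < 3 * r
  to noCN = subst (n + ∣ X ∩ Y ∣ <_) 3r≡
    (+-monoˡ-< ∣ X ∩ Y ∣ (≰⇒> (noCN ∘ Equivalence.from (commonNeighbour⇔ X Y))))

  from : n + ∣ X ∩ Y ∣ < 3 * r → ¬ CommonNeighbour n r X Y
  from n+∣X∩Y∣<3r cn = <⇒≱ n+∣X∩Y∣<3r
    (subst (_≤ n + ∣ X ∩ Y ∣) 3r≡ (+-monoˡ-≤ ∣ X ∩ Y ∣ (Equivalence.to (commonNeighbour⇔ X Y) cn)))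

overlap⇒farApart : ∀ {n r} {X Y : Subset n} → IsVertex n r X → IsVertex n r Y →
                   0 < ∣ X ∩ Y ∣ → n + ∣ X ∩ Y ∣ < 3 * r → FarApart n r X Y
overlap⇒farApart ∣X∣≡r ∣Y∣≡r 0<∣X∩Y∣ n+∣X∩Y∣<3r =
  (λ X∩Y=∅ → m<n⇒n≢0 0<∣X∩Y∣ (Empty⇒∣p∣≡0 X∩Y=∅)) ,
  Equivalence.from (¬commonNeighbour⇔ ∣X∣≡r ∣Y∣≡r) n+∣X∩Y∣<3r

farApart⇒≢ : ∀ {n r} {X Y : Subset n} → 2 * r ≤ n → IsVertex n r X → FarApart n r X Y → X ≢ Y
farApart⇒≢ {n} {r} {X} 2r≤n ∣X∣≡r (_ , noCN) refl =
  noCN (Equivalence.from (commonNeighbour⇔ X X) (subst (_≤ n) 2r≡r+∣X∪X∣ 2r≤n))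
  where
  2r≡r+∣X∪X∣ : 2 * r ≡ r + ∣ X ∪ X ∣
  2r≡r+∣X∪X∣ = cong (r +_) (trans (+-identityʳ r) (sym (trans (cong ∣_∣ (∪-idem X)) ∣X∣≡r)))

allPairs-mapWithAll : ∀ {P : A → Set ℓ₁} {R : A → A → Set ℓ₂} {S : A → A → Set ℓ₃} →
                      (∀ {x y} → P x → P y → R x y → S x y) →
                      ∀ {xs} → All P xs → AllPairs R xs → AllPairs S xs
allPairs-mapWithAll f []         []           = []
allPairs-mapWithAll f (px ∷ pxs) (rxs ∷ rxss) =
  All.zipWith (λ (py , rxy) → f px py rxy) (pxs , rxs) ∷ allPairs-mapWithAll f pxs rxss

farApart⇒2-packing : ∀ {n r P} → 2 * r ≤ n → All (IsVertex n r) P → AllPairs (FarApart n r) P →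
                     Is2Packing n r P
farApart⇒2-packing 2r≤n vertices farPairs =
  vertices , allPairs-mapWithAll (λ ∣X∣≡r _ → farApart⇒≢ 2r≤n ∣X∣≡r) vertices farPairs , farPairs

pairwiseSum : (A → A → ℕ) → List A → ℕ
pairwiseSum f []       = 0
pairwiseSum f (x ∷ xs) = sum (map (f x) xs) + pairwiseSum f xs

sum-map-≡ : ∀ {f : A → ℕ} {c xs} → All (λ x → f x ≡ c) xs → sum (map f xs) ≡ length xs * c
sum-map-≡ []              = refl
sum-map-≡ (fx≡c ∷ fxs≡c) = cong₂ _+_ fx≡c (sum-map-≡ fxs≡c)

sum-map-≤ : ∀ {f : A → ℕ} {c xs} → All (λ x → f x ≤ c) xs → sum (map f xs) ≤ length xs * c
sum-map-≤ []              = z≤n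
sum-map-≤ (fx≤c ∷ fxs≤c) = +-mono-≤ fx≤c (sum-map-≤ fxs≤c)

[1+n]C2≡n+nC2 : ∀ n → suc n C 2 ≡ n + n C 2
[1+n]C2≡n+nC2 n = begin
  suc n C 2      ≡⟨ nCk+nC[k+1]≡[n+1]C[k+1] n 1 ⟨
  n C 1 + n C 2  ≡⟨ cong (_+ n C 2) (nC1≡n n) ⟩
  n + n C 2      ∎
  where open ≡-Reasoning

pairwiseSum-≤ : ∀ {f : A → A → ℕ} {c xs} → AllPairs (λ x y → f x y ≤ c) xs →
                pairwiseSum f xs ≤ (length xs C 2) * c
pairwiseSum-≤                          []              = z≤n
pairwiseSum-≤ {f = f} {c} {xs = x ∷ xs} (fx≤c ∷ fxs≤c) = begin
  sum (map (f x) xs) + pairwiseSum f xs  ≤⟨ +-mono-≤ (sum-map-≤ fx≤c) (pairwiseSum-≤ fxs≤c) ⟩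
  length xs * c + (length xs C 2) * c    ≡⟨ *-distribʳ-+ c (length xs) _ ⟨
  (length xs + length xs C 2) * c        ≡⟨ cong (_* c) ([1+n]C2≡n+nC2 (length xs)) ⟨
  (suc (length xs) C 2) * c              ∎
  where open ≤-Reasoning

∣p∩⋃qs∣≤Σ∣p∩q∣ : ∀ {n} (p : Subset n) qs → ∣ p ∩ ⋃ qs ∣ ≤ sum (map (λ q → ∣ p ∩ q ∣) qs)
∣p∩⋃qs∣≤Σ∣p∩q∣ {n} p []       = ≤-reflexive (trans (cong ∣_∣ (∩-zeroʳ p)) (∣⊥∣≡0 n))
∣p∩⋃qs∣≤Σ∣p∩q∣     p (q ∷ qs) = begin
  ∣ p ∩ (q ∪ ⋃ qs) ∣                          ≡⟨ cong ∣_∣ (∩-distribˡ-∪ p q (⋃ qs)) ⟩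
  ∣ p ∩ q ∪ p ∩ ⋃ qs ∣                        ≤⟨ ∣p∪q∣≤∣p∣+∣q∣ (p ∩ q) (p ∩ ⋃ qs) ⟩
  ∣ p ∩ q ∣ + ∣ p ∩ ⋃ qs ∣                    ≤⟨ +-monoʳ-≤ ∣ p ∩ q ∣ (∣p∩⋃qs∣≤Σ∣p∩q∣ p qs) ⟩
  ∣ p ∩ q ∣ + sum (map (λ q → ∣ p ∩ q ∣) qs)  ∎
  where open ≤-Reasoning

bonferroni : ∀ {n} (ps : List (Subset n)) →
             sum (map ∣_∣ ps) ≤ ∣ ⋃ ps ∣ + pairwiseSum (λ p q → ∣ p ∩ q ∣) ps
bonferroni     []       = z≤n
bonferroni {n} (p ∷ ps) = begin
  ∣ p ∣ + sum (map ∣_∣ ps)                          ≤⟨ +-monoʳ-≤ ∣ p ∣ (bonferroni ps) ⟩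
  ∣ p ∣ + (∣ ⋃ps ∣ + overlaps)                      ≡⟨ +-assoc ∣ p ∣ ∣ ⋃ps ∣ overlaps ⟨
  ∣ p ∣ + ∣ ⋃ps ∣ + overlaps                        ≡⟨ cong (_+ overlaps) (∣p∪q∣+∣p∩q∣≡∣p∣+∣q∣ p ⋃ps) ⟨
  ∣ p ∪ ⋃ps ∣ + ∣ p ∩ ⋃ps ∣ + overlaps              ≤⟨ +-monoˡ-≤ overlaps
                                                         (+-monoʳ-≤ ∣ p ∪ ⋃ps ∣ (∣p∩⋃qs∣≤Σ∣p∩q∣ p ps)) ⟩
  ∣ p ∪ ⋃ps ∣ + sum (map (λ q → ∣ p ∩ q ∣) ps) + overlaps   ≡⟨ +-assoc ∣ p ∪ ⋃ps ∣ _ overlaps ⟩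
  ∣ p ∪ ⋃ps ∣ + (sum (map (λ q → ∣ p ∩ q ∣) ps) + overlaps) ∎
  where
  open ≤-Reasoning
  ⋃ps : Subset n
  ⋃ps = ⋃ ps
  overlaps : ℕ
  overlaps = pairwiseSum (λ p q → ∣ p ∩ q ∣) ps

farApartVertices-bound : ∀ {n r s} → suc n + s ≡ 3 * r → (Q : List (Subset n)) →
                         All (IsVertex n r) Q → AllPairs (FarApart n r) Q →
                         length Q * r ≤ n + (length Q C 2) * s
farApartVertices-bound {n} {r} {s} 1+n+s≡3r Q vertices farPairs = begin
  length Q * r                                  ≡⟨ sum-map-≡ vertices ⟨
  sum (map ∣_∣ Q)                               ≤⟨ bonferroni Q ⟩
  ∣ ⋃ Q ∣ + pairwiseSum (λ X Y → ∣ X ∩ Y ∣) Q  ≤⟨ +-mono-≤ (∣p∣≤n (⋃ Q)) (pairwiseSum-≤ overlaps≤s) ⟩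
  n + (length Q C 2) * s                        ∎
  where
  open ≤-Reasoning
  overlap≤s : ∀ {X Y} → IsVertex n r X → IsVertex n r Y → FarApart n r X Y → ∣ X ∩ Y ∣ ≤ s
  overlap≤s {X} {Y} ∣X∣≡r ∣Y∣≡r (_ , noCN) = +-cancelˡ-≤ (suc n) _ _
    (subst (suc n + ∣ X ∩ Y ∣ ≤_) (sym 1+n+s≡3r) (Equivalence.to (¬commonNeighbour⇔ ∣X∣≡r ∣Y∣≡r) noCN))
  overlaps≤s : AllPairs (λ X Y → ∣ X ∩ Y ∣ ≤ s) Q
  overlaps≤s = allPairs-mapWithAll overlap≤s vertices farPairs

m≡n+1+o⇒m≰n : ∀ {m n o} → m ≡ n + suc o → m ≰ n
m≡n+1+o⇒m≰n {n = n} refl = m+1+n≰m n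

no-5-farApartVertices : ∀ {n r} → 25 * r ≤ 9 * (n + 1) → (Q : List (Subset n)) → length Q ≡ 5 →
                        All (IsVertex n r) Q → AllPairs (FarApart n r) Q → ⊥
no-5-farApartVertices _ []          ()
no-5-farApartVertices _ (_ ∷ [])    ()
no-5-farApartVertices {n} {r} 25r≤9[n+1] Q@(X ∷ Y ∷ _) |Q|≡5
                      vertices@(∣X∣≡r ∷ ∣Y∣≡r ∷ _) farPairs@((X~Y ∷ _) ∷ _) =
  m≡n+1+o⇒m≰n (excess n r s) (+-mono-≤ (+-mono-≤ (*-monoʳ-≤ 9 5r≤n+10s) (*-monoʳ-≤ 9 25r≤9[n+1]))
                                         (*-monoʳ-≤ 90 (≤-reflexive 1+n+s≡3r)))
  where
  1+n≤3r : suc n ≤ 3 * r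
  1+n≤3r = m+n≤o⇒m≤o (suc n) (Equivalence.to (¬commonNeighbour⇔ ∣X∣≡r ∣Y∣≡r) (proj₂ X~Y))
  s : ℕ
  s = proj₁ (m≤n⇒∃[o]m+o≡n 1+n≤3r)
  1+n+s≡3r : suc n + s ≡ 3 * r
  1+n+s≡3r = proj₂ (m≤n⇒∃[o]m+o≡n 1+n≤3r)
  5r≤n+10s : 5 * r ≤ n + 10 * s
  5r≤n+10s = subst (λ k → k * r ≤ n + (k C 2) * s) |Q|≡5
               (farApartVertices-bound 1+n+s≡3r Q vertices farPairs)
  excess : ∀ n r s → 9 * (5 * r) + 9 * (25 * r) + 90 * (suc n + s)
                     ≡ 9 * (n + 10 * s) + 9 * (9 * (n + 1)) + 90 * (3 * r) + suc 8
  excess = solve-∀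

2-packing-length≤4 : ∀ {n r} → 25 * r ≤ 9 * (n + 1) → (P : List (Subset n)) → Is2Packing n r P →
                     length P ≤ 4
2-packing-length≤4 25r≤9[n+1] P (vertices , _ , farPairs) with length P ≤? 4
... | yes |P|≤4 = |P|≤4
... | no  |P|≰4 = ⊥-elim (no-5-farApartVertices 25r≤9[n+1] (take 5 P)
                            (trans (length-take 5 P) (m≤n⇒m⊓n≡m (≰⇒> |P|≰4)))
                            (All.take⁺ 5 vertices) (AllPairs.take⁺ 5 farPairs))

blowUp : (ks : List ℕ) → Subset (length ks) → Subset (sum ks)
blowUp []       []       = []
blowUp (k ∷ ks) (b ∷ bs) = replicate k b ++ blowUp ks bs

weight : (ks : List ℕ) → Subset (length ks) → ℕ
weight []       []             = 0
weight (k ∷ ks) (inside  ∷ bs) = k + weight ks bs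
weight (k ∷ ks) (outside ∷ bs) = weight ks bs

∣blowUp∣≡weight : ∀ ks (b : Subset (length ks)) → ∣ blowUp ks b ∣ ≡ weight ks b
∣blowUp∣≡weight []       []             = refl
∣blowUp∣≡weight (k ∷ ks) (inside  ∷ bs) =
  trans (∣p++q∣≡∣p∣+∣q∣ (replicate k inside) _) (cong₂ _+_ (∣⊤∣≡n k) (∣blowUp∣≡weight ks bs))
∣blowUp∣≡weight (k ∷ ks) (outside ∷ bs) =
  trans (∣p++q∣≡∣p∣+∣q∣ (replicate k outside) _) (cong₂ _+_ (∣⊥∣≡0 k) (∣blowUp∣≡weight ks bs))

blowUp-∩ : ∀ ks (b c : Subset (length ks)) → blowUp ks b ∩ blowUp ks c ≡ blowUp ks (b ∩ c)
blowUp-∩ []       []       []       = refl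
blowUp-∩ (k ∷ ks) (b ∷ bs) (c ∷ cs) = begin
  (replicate k b ++ blowUp ks bs) ∩ (replicate k c ++ blowUp ks cs)
    ≡⟨ zipWith-++ _ (replicate k b) (blowUp ks bs) (replicate k c) (blowUp ks cs) ⟩
  replicate k b ∩ replicate k c ++ blowUp ks bs ∩ blowUp ks cs
    ≡⟨ cong₂ _++_ (zipWith-replicate _ b c) (blowUp-∩ ks bs cs) ⟩
  replicate k (b ∧ c) ++ blowUp ks (bs ∩ cs)
    ∎
  where open ≡-Reasoning

-- Blocks 0–5 belong to the pairs 12, 13, 14, 23, 24, 34 of the four sets, block 6 + i is
-- private to set i, and block 10 is the unused remainder.
blockSizes : ℕ → ℕ → ℕ → List ℕ
blockSizes t p u = t ∷ t ∷ t ∷ t ∷ t ∷ t ∷ p ∷ p ∷ p ∷ p ∷ u ∷ []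

blockPatterns : List (Subset 11)
blockPatterns =
    (inside  ∷ inside  ∷ inside  ∷ outside ∷ outside ∷ outside ∷ inside  ∷ outside ∷ outside ∷ outside ∷ outside ∷ [])
  ∷ (inside  ∷ outside ∷ outside ∷ inside  ∷ inside  ∷ outside ∷ outside ∷ inside  ∷ outside ∷ outside ∷ outside ∷ [])
  ∷ (outside ∷ inside  ∷ outside ∷ inside  ∷ outside ∷ inside  ∷ outside ∷ outside ∷ inside  ∷ outside ∷ outside ∷ [])
  ∷ (outside ∷ outside ∷ inside  ∷ outside ∷ inside  ∷ inside  ∷ outside ∷ outside ∷ outside ∷ inside  ∷ outside ∷ [])
  ∷ []

sum-blockSizes : ∀ t p u → sum (blockSizes t p u) ≡ 6 * t + 4 * p + u
sum-blockSizes = unfolded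
  where
  -- The ring solver does not unfold sum.
  unfolded : ∀ t p u → t + (t + (t + (t + (t + (t + (p + (p + (p + (p + (u + 0))))))))))
                       ≡ 6 * t + 4 * p + u
  unfolded = solve-∀

2-packing-of-size-4 : ∀ {n r} t p u → n ≡ 6 * t + 4 * p + u → r ≡ 3 * t + p → 2 * r ≤ n → 0 < t →
                      n + t < 3 * r → ∃[ P ] Is2Packing n r P × length P ≡ 4
2-packing-of-size-4 {n} {r} t p u n≡ r≡ 2r≤n 0<t n+t<3r
  with refl ← trans n≡ (sym (sum-blockSizes t p u)) | refl ← r≡ =
  map (blowUp ks) blockPatterns ,
  farApart⇒2-packing 2r≤n
    (All.map⁺ {f = blowUp ks} (All.map (λ {b} → vertex b) weights))
    (AllPairs.map⁺ {f = blowUp ks} (allPairs-mapWithAll (λ {b c} → far b c) weights overlaps)) ,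
  refl
  where
  ks : List ℕ
  ks = blockSizes t p u
  weights : All (λ b → weight ks b ≡ t + (t + (t + (p + 0)))) blockPatterns
  weights = refl ∷ refl ∷ refl ∷ refl ∷ []
  overlaps : AllPairs (λ b c → weight ks (b ∩ c) ≡ t + 0) blockPatterns
  overlaps = (refl ∷ refl ∷ refl ∷ []) ∷ (refl ∷ refl ∷ []) ∷ (refl ∷ []) ∷ [] ∷ []
  vertex : ∀ b → weight ks b ≡ t + (t + (t + (p + 0))) → IsVertex (sum ks) (3 * t + p) (blowUp ks b)
  vertex b w = trans (∣blowUp∣≡weight ks b) (trans w (three-blocks t p))
    where
    three-blocks : ∀ t p → t + (t + (t + (p + 0))) ≡ 3 * t + p
    three-blocks = solve-∀
  far : ∀ b c → weight ks b ≡ t + (t + (t + (p + 0))) → weight ks c ≡ t + (t + (t + (p + 0))) →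
        weight ks (b ∩ c) ≡ t + 0 → FarApart (sum ks) (3 * t + p) (blowUp ks b) (blowUp ks c)
  far b c wb wc wbc = overlap⇒farApart (vertex b wb) (vertex c wc)
    (subst (0 <_) (sym ∣∩∣≡t) 0<t) (subst (λ k → sum ks + k < 3 * (3 * t + p)) (sym ∣∩∣≡t) n+t<3r)
    where
    ∣∩∣≡t : ∣ blowUp ks b ∩ blowUp ks c ∣ ≡ t
    ∣∩∣≡t = begin
      ∣ blowUp ks b ∩ blowUp ks c ∣  ≡⟨ cong ∣_∣ (blowUp-∩ ks b c) ⟩
      ∣ blowUp ks (b ∩ c) ∣          ≡⟨ ∣blowUp∣≡weight ks (b ∩ c) ⟩
      weight ks (b ∩ c)              ≡⟨ wbc ⟩
      t + 0                          ≡⟨ +-identityʳ t ⟩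
      t                              ∎
      where open ≡-Reasoning

1+n<3r : ∀ {n r} → 5 * (n + 1) < 14 * r → suc n < 3 * r
1+n<3r {n} {r} 5[n+1]<14r = *-cancelˡ-< 5 (suc n) (3 * r) (begin-strict
  5 * suc n    ≡⟨ cong (5 *_) (+-comm 1 n) ⟩
  5 * (n + 1)  <⟨ 5[n+1]<14r ⟩
  14 * r       ≤⟨ *-monoˡ-≤ r (n≤1+n 14) ⟩
  15 * r       ≡⟨ *-assoc 5 3 r ⟩
  5 * (3 * r)  ∎)
  where open ≤-Reasoning

3t≤r : ∀ {n r t} → 25 * r ≤ 9 * (n + 1) → suc n + t ≡ 3 * r → 3 * t ≤ r
3t≤r {n} {r} {t} 25r≤9[n+1] 1+n+t≡3r = ≮⇒≥ λ r<3t →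
  m≡n+1+o⇒m≰n (excess n r t)
    (+-mono-≤ (+-mono-≤ (*-monoʳ-≤ 3 r<3t) 25r≤9[n+1]) (*-monoʳ-≤ 9 (≤-reflexive 1+n+t≡3r)))
  where
  excess : ∀ n r t → 3 * suc r + 25 * r + 9 * (suc n + t)
                     ≡ 3 * (3 * t) + 9 * (n + 1) + 9 * (3 * r) + suc (r + 2)
  excess = solve-∀

6t+4p≤n : ∀ {n r t p} → 5 * (n + 1) < 14 * r → suc n + t ≡ 3 * r → 3 * t + p ≡ r → 6 * t + 4 * p ≤ n
6t+4p≤n {n} {r} {t} {p} 5[n+1]<14r 1+n+t≡3r 3t+p≡r = ≮⇒≥ λ n<6t+4p →
  m≡n+1+o⇒m≰n (excess n r t p)
    (+-mono-≤ (+-mono-≤ (+-mono-≤ 5[n+1]<14r n<6t+4p) (*-monoʳ-≤ 4 (≤-reflexive 3t+p≡r)))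
              (*-monoʳ-≤ 6 (≤-reflexive (sym 1+n+t≡3r))))
  where
  excess : ∀ n r t p → suc (5 * (n + 1)) + suc n + 4 * (3 * t + p) + 6 * (3 * r)
                       ≡ 14 * r + (6 * t + 4 * p) + 4 * r + 6 * (suc n + t) + suc 0
  excess = solve-∀

blockParameters : ∀ {n r} → 25 * r ≤ 9 * (n + 1) → 5 * (n + 1) < 14 * r →
                  ∃[ t ] ∃[ p ] ∃[ u ] n ≡ 6 * t + 4 * p + u × r ≡ 3 * t + p × 0 < t × n + t < 3 * r
blockParameters {n} {r} 25r≤9[n+1] 5[n+1]<14r =
  let t-1 , 2+n+t-1≡3r = m≤n⇒∃[o]m+o≡n (1+n<3r {n} {r} 5[n+1]<14r)
      t                = suc t-1
      1+n+t≡3r         = trans (cong suc (+-suc n t-1)) 2+n+t-1≡3r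
      p , 3t+p≡r       = m≤n⇒∃[o]m+o≡n (3t≤r {n} {r} {t} 25r≤9[n+1] 1+n+t≡3r)
      u , 6t+4p+u≡n    = m≤n⇒∃[o]m+o≡n (6t+4p≤n {n} {r} {t} {p} 5[n+1]<14r 1+n+t≡3r 3t+p≡r)
  in t , p , u , sym 6t+4p+u≡n , sym 3t+p≡r , z<s , ≤-reflexive 1+n+t≡3r

mainTheorem16 : (n r : ℕ) → 1 ≤ r → 2 * r ≤ n
    → 25 * r ≤ 9 * (n + 1) → 5 * (n + 1) < 14 * r
    → ρ₂≡ n r 4
-- The hypothesis 1 ≤ r is implied by 5(n + 1) < 14r.
mainTheorem16 n r _ 2r≤n 25r≤9[n+1] 5[n+1]<14r =
  let t , p , u , n≡ , r≡ , 0<t , n+t<3r = blockParameters 25r≤9[n+1] 5[n+1]<14r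
  in 2-packing-of-size-4 t p u n≡ r≡ 2r≤n 0<t n+t<3r , 2-packing-length≤4 25r≤9[n+1]
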